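{- Let $V:\mathsf{FOR}\to U$ be defined on atoms by $V(p)=u$, where $u\in\mathsf{ML}_{\mathcal{B}}$ is such that $w\sim u$ for some $w\in\mathsf{L}_{\mathcal{B}}$ with $w:p$ on $\mathcal{B}$, if such $w$ exists, and $V(p)=\mathbf{w}^+$ otherwise; and extended by $V(\neg\psi)=\tilde\neg V(\psi)$, $V(\psi\to\theta)=V(\psi)\tilde\to V(\theta)$, $V(\psi\equiv\theta)=V(\psi)\tilde\equiv V(\theta)$. Then $V$ is well defined and it is a valuation in the branch model $\mathcal{M}_{\mathcal{B}}$ defined in the context.
   Context: A valuation in an SCI-model $\langle U,D,\tilde\neg,\tilde\to,\tilde\equiv\rangle$ is a map $V:\mathsf{FOR}\to U$ with $V(\neg\varphi)=\tilde\neg V(\varphi)$, $V(\varphi\to\psi)=V(\varphi)\tilde\to V(\psi)$, $V(\varphi\equiv\psi)=V(\varphi)\tilde\equiv V(\psi)$. SCI-formulas: over a countably infinite set $\mathsf{AF}$ of atoms, $\varphi ::= p \mid \neg\varphi \mid \varphi\to\varphi \mid \varphi\equiv\varphi$; $\mathsf{FOR}$ is the set of formulas. Tableau system $\mathsf{TC}_{\mathsf{SCI}}$. Let $\mathsf{L}^+,\mathsf{L}^-$ be disjoint countably infinite sets of labels, $\mathsf{L}=\mathsf{L}^+\cup\mathsf{L}^-$; a label written $w^+$ lies in $\mathsf{L}^+$, $w^-$ in $\mathsf{L}^-$, unsuperscripted labels are arbitrary. A labelled formula is $w:\varphi$; equality statements $w=v$ and inequality statements $w\neq v$ may also occur. A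 tableau is a tree whose nodes carry these items or $\bot$; a branch is a root-to-leaf path identified with its set of items. Rules (premises / alternative conclusion sets separated by $\mid$): decomposition rules (conclusion labels fresh on the branch): $(\neg^+)$ $w^+:\neg\varphi$ / $v^-:\varphi$; $(\neg^-)$ $w^-:\neg\varphi$ / $v^+:\varphi$; $(\to^+)$ $w^+:\varphi\to\psi$ / $\{v^-:\varphi,u^-:\psi\}\mid\{v^-:\varphi,u^+:\psi\}\mid\{v^+:\varphi,u^+:\psi\}$; $(\to^-)$ $w^-:\varphi\to\psi$ / $\{v^+:\varphi,u^-:\psi\}$; $(\equiv^+)$ $w^+:\varphi\equiv\psi$ / $\{v^+:\varphi,u^+:\psi,v^+=u^+\}\mid\{v^-:\varphi,u^-:\psi,v^-=u^-\}$; $(\equiv^-)$ $w^-:\varphi\equiv\psi$ / $\{v^+:\varphi,u^+:\psi,v^+\neq u^+\}\mid\{v^+:\varphi,u^-:\psi\}\mid\{v^-:\varphi,u^+:\psi\}\mid\{v^-:\varphi,u^-:\psi,v^-\neq u^-\}$. Equality rules, with $\varphi\approx\psi$ abbreviating premises $w:\varphi$, $v:\psi$, $w=v$: $(\equiv^\neg)$ $\varphi\approx\psi$, $u:\neg\varphi$, $y:\neg\psi$ / $u=y$; $(\equiv^\to)$ $\varphi\approx\psi$, $\chi\approx\theta$, $x:\varphi\to\chi$, $z:\psi\to\theta$ / $x=z$; $(\equiv^\equiv)$ $\varphi\approx\psi$, $\chi\approx\theta$, $x:\varphi\equiv\chi$, $z:\psi\equiv\theta$ / $x=z$; $(\mathsf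 F)$ $w:\varphi$, $v:\varphi$ / $w=v$; $(\mathsf{sym})$ $w=v$ / $v=w$; $(\mathsf{tran})$ $w=v$, $v=u$ / $w=u$. Closure rules: $(\bot_1)$ $w=v$, $w\neq v$ / $\bot$; $(\bot_2)$ $w^+=v^-$ / $\bot$. A decomposition rule may be applied to $w:\varphi$ on a branch only once; an equality rule only if its conclusion is not yet on the branch; closure rules are applied eagerly. A branch is closed if a closure rule was applied on it, open otherwise; fully expanded if closed or no rule is applicable. Branch model. Let $\varphi\in\mathsf{FOR}$, $\mathbf{w}^-\in\mathsf{L}^-$, and $\mathcal{B}$ an open fully expanded branch of a tableau with root $\mathbf{w}^-:\varphi$. $\mathsf{L}_{\mathcal{B}}$ is the set of labels $w$ with $w:\psi$ on $\mathcal{B}$ for some $\psi$; $\mathsf{L}_{\mathcal{B}}^\pm=\mathsf{L}_{\mathcal{B}}\cap\mathsf{L}^\pm$; $w\sim v$ iff $w=v$ occurs on $\mathcal{B}$ (an equivalence relation on $\mathsf{L}_{\mathcal{B}}$). $\mathsf{ML}_{\mathcal{B}}^+$ contains exactly one label from each $\sim$-class of $\mathsf{L}_{\mathcal{B}}^+$; $\mathsf{ML}_{\mathcal{B}}^-$ exactly one from each $\sim$-class of $\mathsf{L}_{\mathcal{B}}^-$, with $\mathbf{w}^-\in\mathsf{ML}_{\mathcal{B}}^-$; $\mathsf{ML}_{\mathcal{B}}=\mathsf{ML}_{\mathcal{B}}^+\cup\mathsf{ML}_{\mathcal{B}}^-$. Let $\mathbf{w}^+$ be an object not in $\mathsf{L}_{\mathcal{B}}$;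 for $w\in U$ and a label $t$, "$w\sim t$" is false if $w=\mathbf{w}^+$. $w\in\mathsf{ML}_{\mathcal{B}}$ is $(\neg)$-closed if there are $\psi$, $u\in\mathsf{ML}_{\mathcal{B}}$, $v,t\in\mathsf{L}_{\mathcal{B}}$ with $w\sim v$, $u\sim t$, and $v:\psi$, $t:\neg\psi$ on $\mathcal{B}$. For $\#\in\{\to,\equiv\}$, $(w,v)\in\mathsf{ML}_{\mathcal{B}}^2$ is $(\#)$-closed if there are $\psi,\theta$, $u\in\mathsf{ML}_{\mathcal{B}}$, $t,x,y\in\mathsf{L}_{\mathcal{B}}$ with $w\sim t$, $v\sim x$, $u\sim y$ and $t:\psi$, $x:\theta$, $y:(\psi\#\theta)$ on $\mathcal{B}$ ($\mathbf{w}^+$ and pairs involving it are never closed). $D=\mathsf{ML}_{\mathcal{B}}^+\cup\{\mathbf{w}^+\}$, $U=D\cup\mathsf{ML}_{\mathcal{B}}^-$. For $w,v\in U$: $\tilde\neg w=u\in\mathsf{ML}_{\mathcal{B}}$ if there are $\psi$ and $v',t\in\mathsf{L}_{\mathcal{B}}$ with $w\sim v'$, $u\sim t$, $v':\psi$, $t:\neg\psi$ on $\mathcal{B}$; $=\mathbf{w}^+$ if $w$ is not $(\neg)$-closed and $w\notin D$; $=\mathbf{w}^-$ otherwise. $w\tilde\to v=u\in\mathsf{ML}_{\mathcal{B}}$ if there are $\psi,\theta$, $t,x,y\in\mathsf{L}_{\mathcal{B}}$ with $w\sim t$, $v\sim x$, $u\sim y$, $t:\psi$, $x:\theta$, $y:(\psi\to\theta)$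 on $\mathcal{B}$; $=\mathbf{w}^+$ if $v=\mathbf{w}^+$, or ($w=\mathbf{w}^+$ and $v\in D$), or ($(w,v)$ not $(\to)$-closed and ($w\notin D$ or $v\in D$)); $=\mathbf{w}^-$ otherwise. $w\tilde\equiv v=u\in\mathsf{ML}_{\mathcal{B}}$ if there are $\psi,\theta$, $t,x,y\in\mathsf{L}_{\mathcal{B}}$ with $w\sim t$, $v\sim x$, $u\sim y$, $t:\psi$, $x:\theta$, $y:(\psi\equiv\theta)$ on $\mathcal{B}$; $=\mathbf{w}^+$ if $w=v$ and ($w=\mathbf{w}^+$ or $(w,v)$ not $(\equiv)$-closed); $=\mathbf{w}^-$ otherwise. $\mathcal{M}_{\mathcal{B}}=\langle U,D,\tilde\neg,\tilde\to,\tilde\equiv\rangle$. -}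

module Defs where

open import Data.Nat using (ℕ)
open import Data.Product using (Σ; ∃; ∃-syntax; _×_; _,_)
open import Data.Sum using (_⊎_)
open import Data.Empty using (⊥)
open import Data.Unit using (⊤)
open import Data.List using (List; []; _∷_; _++_)
open import Data.List.Membership.Propositional using (_∈_; _∉_)
open import Data.List.Relation.Unary.All using (All)
open import Data.List.Relation.Unary.Unique.Propositional using (Unique)
open import Relation.Nullary using (¬_)
open import Relation.Binary.PropositionalEquality using (_≡_)

infixr 8 _⇒_
infix 7 _≡f_

data FOR : Set where
  var  : ℕ → FOR
  ¬f   : FOR → FOR
  _⇒_  : FOR → FOR → FOR
  _≡f_ : FOR → FOR → FOR

-- Labels: L⁺ = { plus n }, L⁻ = { minus n }  (disjoint, countably infinite)

data Label : Set where
  plus  : ℕ → Label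
  minus : ℕ → Label

data Item : Set where
  _∶_  : Label → FOR → Item
  _≐_  : Label → Label → Item
  _≠_  : Label → Label → Item
  bot  : Item

infix 6 _∶_ _≐_ _≠_

-- A (partial) branch is identified with the set of its items.
Branch : Set
Branch = List Item

Occurs : Label → Item → Set
Occurs l (w ∶ φ) = w ≡ l
Occurs l (w ≐ v) = w ≡ l ⊎ v ≡ l
Occurs l (w ≠ v) = w ≡ l ⊎ v ≡ l
Occurs l bot     = ⊥

Fresh : Branch → Label → Set
Fresh B l = ∀ {i} → i ∈ B → ¬ Occurs l i

-- Decomposition rules.  Dec w φ ls cs : applying the rule for premise
-- w : φ, one of the alternative conclusion sets is cs, whose (new)
-- labels are ls.

data Dec : Label → FOR → List Label → List Item → Set where
  neg⁺  : ∀ {i j φ} → Dec (plus i) (¬f φ) (minus j ∷ []) (minus j ∶ φ ∷ [])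
  neg⁻  : ∀ {i j φ} → Dec (minus i) (¬f φ) (plus j ∷ []) (plus j ∶ φ ∷ [])
  imp⁺₁ : ∀ {i j k φ ψ} → Dec (plus i) (φ ⇒ ψ) (minus j ∷ minus k ∷ [])
            (minus j ∶ φ ∷ minus k ∶ ψ ∷ [])
  imp⁺₂ : ∀ {i j k φ ψ} → Dec (plus i) (φ ⇒ ψ) (minus j ∷ plus k ∷ [])
            (minus j ∶ φ ∷ plus k ∶ ψ ∷ [])
  imp⁺₃ : ∀ {i j k φ ψ} → Dec (plus i) (φ ⇒ ψ) (plus j ∷ plus k ∷ [])
            (plus j ∶ φ ∷ plus k ∶ ψ ∷ [])
  imp⁻  : ∀ {i j k φ ψ} → Dec (minus i) (φ ⇒ ψ) (plus j ∷ minus k ∷ [])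
            (plus j ∶ φ ∷ minus k ∶ ψ ∷ [])
  eqv⁺₁ : ∀ {i j k φ ψ} → Dec (plus i) (φ ≡f ψ) (plus j ∷ plus k ∷ [])
            (plus j ∶ φ ∷ plus k ∶ ψ ∷ plus j ≐ plus k ∷ [])
  eqv⁺₂ : ∀ {i j k φ ψ} → Dec (plus i) (φ ≡f ψ) (minus j ∷ minus k ∷ [])
            (minus j ∶ φ ∷ minus k ∶ ψ ∷ minus j ≐ minus k ∷ [])
  eqv⁻₁ : ∀ {i j k φ ψ} → Dec (minus i) (φ ≡f ψ) (plus j ∷ plus k ∷ [])
            (plus j ∶ φ ∷ plus k ∶ ψ ∷ plus j ≠ plus k ∷ [])
  eqv⁻₂ : ∀ {i j k φ ψ} → Dec (minus i) (φ ≡f ψ) (plus j ∷ minus k ∷ [])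
            (plus j ∶ φ ∷ minus k ∶ ψ ∷ [])
  eqv⁻₃ : ∀ {i j k φ ψ} → Dec (minus i) (φ ≡f ψ) (minus j ∷ plus k ∷ [])
            (minus j ∶ φ ∷ plus k ∶ ψ ∷ [])
  eqv⁻₄ : ∀ {i j k φ ψ} → Dec (minus i) (φ ≡f ψ) (minus j ∷ minus k ∷ [])
            (minus j ∶ φ ∷ minus k ∶ ψ ∷ minus j ≠ minus k ∷ [])

Approx : Branch → FOR → FOR → Set
Approx B φ ψ = ∃[ w ] ∃[ v ] ((w ∶ φ) ∈ B × (v ∶ ψ) ∈ B × (w ≐ v) ∈ B)

data EqConcl (B : Branch) : Item → Set where
  r≡¬ : ∀ {φ ψ u y} → Approx B φ ψ → (u ∶ ¬f φ) ∈ B → (y ∶ ¬f ψ) ∈ B →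
        EqConcl B (u ≐ y)
  r≡⇒ : ∀ {φ ψ χ θ x z} → Approx B φ ψ → Approx B χ θ →
        (x ∶ φ ⇒ χ) ∈ B → (z ∶ ψ ⇒ θ) ∈ B → EqConcl B (x ≐ z)
  r≡≡ : ∀ {φ ψ χ θ x z} → Approx B φ ψ → Approx B χ θ →
        (x ∶ φ ≡f χ) ∈ B → (z ∶ ψ ≡f θ) ∈ B → EqConcl B (x ≐ z)
  rF  : ∀ {φ w v} → (w ∶ φ) ∈ B → (v ∶ φ) ∈ B → EqConcl B (w ≐ v)
  rsym  : ∀ {w v} → (w ≐ v) ∈ B → EqConcl B (v ≐ w)
  rtran : ∀ {w v u} → (w ≐ v) ∈ B → (v ≐ u) ∈ B → EqConcl B (w ≐ u)

ClosurePremise : Branch → Set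
ClosurePremise B =
  (∃[ w ] ∃[ v ] ((w ≐ v) ∈ B × (w ≠ v) ∈ B)) ⊎
  (∃[ i ] ∃[ j ] ((plus i ≐ minus j) ∈ B))

-- TBranch r φ B A : B is (the item set of) a branch of some tableau
-- with root  minus r ∶ φ  built by the rules, and A records the labelled
-- formulas to which a decomposition rule has already been applied on B.

data TBranch (r : ℕ) (φ : FOR) : Branch → List (Label × FOR) → Set where
  root  : TBranch r φ ((minus r ∶ φ) ∷ []) []
  decS  : ∀ {B A w ψ ls cs} → TBranch r φ B A →
          (w ∶ ψ) ∈ B → (w , ψ) ∉ A → Dec w ψ ls cs →
          All (Fresh B) ls → Unique ls →
          TBranch r φ (cs ++ B) ((w , ψ) ∷ A)
  eqS   : ∀ {B A c} → TBranch r φ B A → EqConcl B c → c ∉ B →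
          TBranch r φ (c ∷ B) A
  cloS  : ∀ {B A} → TBranch r φ B A → ClosurePremise B → bot ∉ B →
          TBranch r φ (bot ∷ B) A

Open : Branch → Set
Open B = bot ∉ B

NoRuleApplicable : Branch → List (Label × FOR) → Set
NoRuleApplicable B A =
  (∀ {w ψ} → (w ∶ ψ) ∈ B → (∃[ ls ] ∃[ cs ] Dec w ψ ls cs) → (w , ψ) ∈ A) ×
  (∀ {c} → EqConcl B c → c ∈ B) ×
  ¬ ClosurePremise B

FullyExpanded : Branch → List (Label × FOR) → Set
FullyExpanded B A = bot ∈ B ⊎ NoRuleApplicable B A

InL : Branch → Label → Set
InL B w = ∃[ ψ ] ((w ∶ ψ) ∈ B)

Sim : Branch → Label → Label → Set
Sim B w v = (w ≐ v) ∈ B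

IsPlus : Label → Set
IsPlus (plus _)  = ⊤
IsPlus (minus _) = ⊥

IsMinus : Label → Set
IsMinus (plus _)  = ⊥
IsMinus (minus _) = ⊤

IsML : Branch → ℕ → (Label → Set) → Set
IsML B r ML =
  (∀ {u} → ML u → InL B u) ×
  (∀ {w} → InL B w → IsPlus w → ∃[ u ] (ML u × IsPlus u × Sim B w u)) ×
  (∀ {u u'} → ML u → IsPlus u → ML u' → IsPlus u' → Sim B u u' → u ≡ u') ×
  (∀ {w} → InL B w → IsMinus w → ∃[ u ] (ML u × IsMinus u × Sim B w u)) ×
  (∀ {u u'} → ML u → IsMinus u → ML u' → IsMinus u' → Sim B u u' → u ≡ u') ×
  ML (minus r)

data Elem : Set where
  w⁺  : Elem
  ⌜_⌝ : Label → Elem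

module BranchModel (B : Branch) (ML : Label → Set) (r : ℕ) where

  w⁻ : Elem
  w⁻ = ⌜ minus r ⌝

  InU : Elem → Set
  InU w⁺     = ⊤
  InU ⌜ l ⌝  = ML l

  InD : Elem → Set
  InD w⁺     = ⊤
  InD ⌜ l ⌝  = ML l × IsPlus l

  SimE : Elem → Label → Set
  SimE w⁺ t    = ⊥
  SimE ⌜ w ⌝ t = Sim B w t

  NegWit : Elem → Label → Set
  NegWit w u = ∃[ ψ ] ∃[ v' ] ∃[ t ]
    (SimE w v' × Sim B u t × (v' ∶ ψ) ∈ B × (t ∶ ¬f ψ) ∈ B)

  ImpWit : Elem → Elem → Label → Set
  ImpWit w v u = ∃[ ψ ] ∃[ θ ] ∃[ t ] ∃[ x ] ∃[ y ]
    (SimE w t × SimE v x × Sim B u y ×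
     (t ∶ ψ) ∈ B × (x ∶ θ) ∈ B × (y ∶ ψ ⇒ θ) ∈ B)

  EqvWit : Elem → Elem → Label → Set
  EqvWit w v u = ∃[ ψ ] ∃[ θ ] ∃[ t ] ∃[ x ] ∃[ y ]
    (SimE w t × SimE v x × Sim B u y ×
     (t ∶ ψ) ∈ B × (x ∶ θ) ∈ B × (y ∶ ψ ≡f θ) ∈ B)

  NegClosed : Elem → Set
  NegClosed w = ∃[ u ] (ML u × NegWit w u)

  ImpClosed : Elem → Elem → Set
  ImpClosed w v = ∃[ u ] (ML u × ImpWit w v u)

  EqvClosed : Elem → Elem → Set
  EqvClosed w v = ∃[ u ] (ML u × EqvWit w v u)

  NegCond₂ : Elem → Set
  NegCond₂ w = ¬ NegClosed w × ¬ InD w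

  ImpCond₂ : Elem → Elem → Set
  ImpCond₂ w v = v ≡ w⁺ ⊎ (w ≡ w⁺ × InD v) ⊎
                 (¬ ImpClosed w v × (¬ InD w ⊎ InD v))

  EqvCond₂ : Elem → Elem → Set
  EqvCond₂ w v = w ≡ v × (w ≡ w⁺ ⊎ ¬ EqvClosed w v)

  -- graphs of  ~¬ , ~→ , ~≡  as defined clause by clause
  NegR : Elem → Elem → Set
  NegR w o =
    (∃[ u ] (o ≡ ⌜ u ⌝ × ML u × NegWit w u)) ⊎
    (o ≡ w⁺ × NegCond₂ w) ⊎
    (o ≡ w⁻ × ¬ (∃[ u ] (ML u × NegWit w u)) × ¬ NegCond₂ w)

  ImpR : Elem → Elem → Elem → Set
  ImpR w v o =
    (∃[ u ] (o ≡ ⌜ u ⌝ × ML u × ImpWit w v u)) ⊎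
    (o ≡ w⁺ × ImpCond₂ w v) ⊎
    (o ≡ w⁻ × ¬ (∃[ u ] (ML u × ImpWit w v u)) × ¬ ImpCond₂ w v)

  EqvR : Elem → Elem → Elem → Set
  EqvR w v o =
    (∃[ u ] (o ≡ ⌜ u ⌝ × ML u × EqvWit w v u)) ⊎
    (o ≡ w⁺ × EqvCond₂ w v) ⊎
    (o ≡ w⁻ × ¬ (∃[ u ] (ML u × EqvWit w v u)) × ¬ EqvCond₂ w v)

  AtomR : ℕ → Elem → Set
  AtomR p o =
    (∃[ w ] ((w ∶ var p) ∈ B × ∃[ u ] (o ≡ ⌜ u ⌝ × ML u × Sim B w u))) ⊎
    (o ≡ w⁺ × ¬ (∃[ w ] ((w ∶ var p) ∈ B)))

  ModelWellDefined : Set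
  ModelWellDefined =
    (∀ w → InU w → Σ Elem λ o → InU o × NegR w o × (∀ o' → NegR w o' → o' ≡ o)) ×
    (∀ w v → InU w → InU v →
       Σ Elem λ o → InU o × ImpR w v o × (∀ o' → ImpR w v o' → o' ≡ o)) ×
    (∀ w v → InU w → InU v →
       Σ Elem λ o → InU o × EqvR w v o × (∀ o' → EqvR w v o' → o' ≡ o))

  -- V : FOR → U satisfies the defining clauses of the proposition
  -- (equivalently, once the operations are functions: V is a valuation in
  -- M_B with the prescribed values on atoms)
  IsDefinedV : (FOR → Elem) → Set
  IsDefinedV V =
    (∀ ψ → InU (V ψ)) ×
    (∀ p → AtomR p (V (var p))) ×
    (∀ ψ → NegR (V ψ) (V (¬f ψ))) ×
    (∀ ψ θ → ImpR (V ψ) (V θ) (V (ψ ⇒ θ))) ×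
    (∀ ψ θ → EqvR (V ψ) (V θ) (V (ψ ≡f θ)))

  AtomWellDefined : Set
  AtomWellDefined =
    ∀ p → Σ Elem λ o → InU o × AtomR p o × (∀ o' → AtomR p o' → o' ≡ o)

  Conclusion : Set
  Conclusion =
    ModelWellDefined × AtomWellDefined ×
    Σ (FOR → Elem) λ V → IsDefinedV V ×
      (∀ V' → IsDefinedV V' → ∀ ψ → V' ψ ≡ V ψ)

{-# OPTIONS --safe #-}
-- Each operation of the branch model is defined by three clauses.  On an open, fully
-- expanded branch the first clause has at most one witness in ML: the congruence rules
-- (≡¬), (≡→), (≡≡) and (F) put all candidate labels into one ∼-class, which never mixes
-- L⁺ and L⁻ because (⊥₂) does not apply, and ML picks one label per class.  The first
-- clause excludes the second, and every clause is decidable since a branch is a finite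
-- list of items.  So the atom clause and the three operations are functions on U, and V
-- is defined by structural recursion; any V' satisfying the clauses agrees with it by
-- induction on formulas.
module Submission where

open import Defs hiding (Dec)
open import Data.Nat using (ℕ)
open import Data.List using (List)
open import Data.Product using (_×_)

open import Data.Nat.Properties using (_≟_)
open import Data.Product using (Σ; ∃-syntax; _,_; proj₁; proj₂; uncurry)
open import Data.Sum using (_⊎_; inj₁; inj₂)
open import Data.Empty using (⊥; ⊥-elim)
open import Data.Unit using (tt)
open import Data.List.Membership.Propositional using (_∈_; find; lose)
open import Data.List.Relation.Unary.Any using (any?)
open import Relation.Nullary using (¬_)
open import Relation.Nullary.Decidable
  using (Dec; yes; no; map′; _×-dec_; _⊎-dec_; ¬?)
open import Relation.Unary using (Decidable)
open import Function using (_∘_)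
open import Relation.Binary.Definitions using (DecidableEquality)
open import Relation.Binary.PropositionalEquality
  using (_≡_; refl; cong; cong₂; subst; subst₂)

_≟ᴸ_ : DecidableEquality Label
plus m  ≟ᴸ plus n  = map′ (cong plus) (λ { refl → refl }) (m ≟ n)
minus m ≟ᴸ minus n = map′ (cong minus) (λ { refl → refl }) (m ≟ n)
plus _  ≟ᴸ minus _ = no λ ()
minus _ ≟ᴸ plus _  = no λ ()

_≟ᶠ_ : DecidableEquality FOR
var m    ≟ᶠ var n    = map′ (cong var) (λ { refl → refl }) (m ≟ n)
¬f φ     ≟ᶠ ¬f ψ     = map′ (cong ¬f) (λ { refl → refl }) (φ ≟ᶠ ψ)
(φ ⇒ ψ)  ≟ᶠ (χ ⇒ θ)  =
  map′ (uncurry (cong₂ _⇒_)) (λ { refl → refl , refl }) (φ ≟ᶠ χ ×-dec ψ ≟ᶠ θ)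
(φ ≡f ψ) ≟ᶠ (χ ≡f θ) =
  map′ (uncurry (cong₂ _≡f_)) (λ { refl → refl , refl }) (φ ≟ᶠ χ ×-dec ψ ≟ᶠ θ)
var _    ≟ᶠ ¬f _     = no λ ()
var _    ≟ᶠ (_ ⇒ _)  = no λ ()
var _    ≟ᶠ (_ ≡f _) = no λ ()
¬f _     ≟ᶠ var _    = no λ ()
¬f _     ≟ᶠ (_ ⇒ _)  = no λ ()
¬f _     ≟ᶠ (_ ≡f _) = no λ ()
(_ ⇒ _)  ≟ᶠ var _    = no λ ()
(_ ⇒ _)  ≟ᶠ ¬f _     = no λ ()
(_ ⇒ _)  ≟ᶠ (_ ≡f _) = no λ ()
(_ ≡f _) ≟ᶠ var _    = no λ ()
(_ ≡f _) ≟ᶠ ¬f _     = no λ ()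
(_ ≡f _) ≟ᶠ (_ ⇒ _)  = no λ ()

_≟ⁱ_ : DecidableEquality Item
(w ∶ φ) ≟ⁱ (v ∶ ψ) =
  map′ (uncurry (cong₂ _∶_)) (λ { refl → refl , refl }) (w ≟ᴸ v ×-dec φ ≟ᶠ ψ)
(w ≐ u) ≟ⁱ (v ≐ t) =
  map′ (uncurry (cong₂ _≐_)) (λ { refl → refl , refl }) (w ≟ᴸ v ×-dec u ≟ᴸ t)
(w ≠ u) ≟ⁱ (v ≠ t) =
  map′ (uncurry (cong₂ _≠_)) (λ { refl → refl , refl }) (w ≟ᴸ v ×-dec u ≟ᴸ t)
bot     ≟ⁱ bot     = yes refl
(_ ∶ _) ≟ⁱ (_ ≐ _) = no λ ()
(_ ∶ _) ≟ⁱ (_ ≠ _) = no λ ()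
(_ ∶ _) ≟ⁱ bot     = no λ ()
(_ ≐ _) ≟ⁱ (_ ∶ _) = no λ ()
(_ ≐ _) ≟ⁱ (_ ≠ _) = no λ ()
(_ ≐ _) ≟ⁱ bot     = no λ ()
(_ ≠ _) ≟ⁱ (_ ∶ _) = no λ ()
(_ ≠ _) ≟ⁱ (_ ≐ _) = no λ ()
(_ ≠ _) ≟ⁱ bot     = no λ ()
bot     ≟ⁱ (_ ∶ _) = no λ ()
bot     ≟ⁱ (_ ≐ _) = no λ ()
bot     ≟ⁱ (_ ≠ _) = no λ ()

open import Data.List.Membership.DecPropositional _≟ⁱ_ using (_∈?_)

Labelled : (Label → FOR → Set) → Item → Set
Labelled P (w ∶ φ) = P w φ
Labelled P (_ ≐ _) = ⊥
Labelled P (_ ≠ _) = ⊥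
Labelled P bot     = ⊥

labelled? : {P : Label → FOR → Set} → (∀ w φ → Dec (P w φ)) → Decidable (Labelled P)
labelled? P? (w ∶ φ) = P? w φ
labelled? P? (_ ≐ _) = no λ ()
labelled? P? (_ ≠ _) = no λ ()
labelled? P? bot     = no λ ()

∃-labelled? : {P : Label → FOR → Set} → (∀ w φ → Dec (P w φ)) → (B : Branch) →
              Dec (∃[ w ] ∃[ φ ] ((w ∶ φ) ∈ B × P w φ))
∃-labelled? {P} P? B =
  map′ (labelledItem ∘ find) (λ (_ , _ , m , p) → lose m p) (any? (labelled? P?) B)
  where
  labelledItem : ∃[ i ] (i ∈ B × Labelled P i) → ∃[ w ] ∃[ φ ] ((w ∶ φ) ∈ B × P w φ)
  labelledItem ((w ∶ φ) , m , p) = w , φ , m , p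
  labelledItem ((_ ≐ _) , _ , ())
  labelledItem ((_ ≠ _) , _ , ())
  labelledItem (bot     , _ , ())

_≟ᵉ_ : DecidableEquality Elem
w⁺    ≟ᵉ w⁺    = yes refl
⌜ a ⌝ ≟ᵉ ⌜ b ⌝ = map′ (cong ⌜_⌝) (λ { refl → refl }) (a ≟ᴸ b)
w⁺    ≟ᵉ ⌜ _ ⌝ = no λ ()
⌜ _ ⌝ ≟ᵉ w⁺    = no λ ()

module BranchModelProperties (B : Branch) (ML : Label → Set) (r : ℕ) where
  open BranchModel B ML r

  UniqueInU : (Elem → Set) → Set
  UniqueInU R = Σ Elem λ o → InU o × R o × (∀ o' → R o' → o' ≡ o)

  InD? : ∀ w → InU w → Dec (InD w)
  InD? w⁺             _    = yes tt
  InD? ⌜ plus _ ⌝     u∈ML = yes (u∈ML , tt)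
  InD? ⌜ minus _ ⌝    _    = no proj₂

  CaseDefined : (Label → Set) → Set → Elem → Set
  CaseDefined Wit C o =
    (∃[ u ] (o ≡ ⌜ u ⌝ × ML u × Wit u)) ⊎
    (o ≡ w⁺ × C) ⊎
    (o ≡ w⁻ × ¬ (∃[ u ] (ML u × Wit u)) × ¬ C)

  caseDefined-unique : {Wit : Label → Set} {C : Set} → InU w⁻ →
    Dec (∃[ u ] (ML u × Wit u)) →
    (∀ {u u'} → ML u → Wit u → ML u' → Wit u' → u ≡ u') →
    Dec C → (∃[ u ] (ML u × Wit u) → ¬ C) →
    UniqueInU (CaseDefined Wit C)
  caseDefined-unique _ (yes (u , u∈ML , wit)) wit-unique _ excludes =
    ⌜ u ⌝ , u∈ML , inj₁ (u , refl , u∈ML , wit) , λ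
      { _ (inj₁ (u' , refl , u'∈ML , wit')) → cong ⌜_⌝ (wit-unique u'∈ML wit' u∈ML wit)
      ; _ (inj₂ (inj₁ (_ , c)))             → ⊥-elim (excludes (u , u∈ML , wit) c)
      ; _ (inj₂ (inj₂ (_ , none , _)))      → ⊥-elim (none (u , u∈ML , wit)) }
  caseDefined-unique _ (no none) _ (yes c) _ =
    w⁺ , tt , inj₂ (inj₁ (refl , c)) , λ
      { _ (inj₁ (u , _ , u∈ML , wit))  → ⊥-elim (none (u , u∈ML , wit))
      ; _ (inj₂ (inj₁ (o≡w⁺ , _)))     → o≡w⁺
      ; _ (inj₂ (inj₂ (_ , _ , ¬c)))   → ⊥-elim (¬c c) }
  caseDefined-unique w⁻∈U (no none) _ (no ¬c) _ =
    w⁻ , w⁻∈U , inj₂ (inj₂ (refl , none , ¬c)) , λ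
      { _ (inj₁ (u , _ , u∈ML , wit))  → ⊥-elim (none (u , u∈ML , wit))
      ; _ (inj₂ (inj₁ (_ , c)))        → ⊥-elim (¬c c)
      ; _ (inj₂ (inj₂ (o≡w⁻ , _)))     → o≡w⁻ }

  valuation : ModelWellDefined → AtomWellDefined →
    Σ (FOR → Elem) λ V → IsDefinedV V × (∀ V' → IsDefinedV V' → ∀ ψ → V' ψ ≡ V ψ)
  valuation (neg , imp , eqv) atom =
    V , (V∈U , (λ p → holds (atom p)) , negV , impV , eqvV) , unique
    where
    value : ∀ {R} → UniqueInU R → Elem
    value = proj₁

    value∈U : ∀ {R} (d : UniqueInU R) → InU (value d)
    value∈U = proj₁ ∘ proj₂

    holds : ∀ {R} (d : UniqueInU R) → R (value d)
    holds = proj₁ ∘ proj₂ ∘ proj₂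

    only : ∀ {R} (d : UniqueInU R) {o} → R o → o ≡ value d
    only d = proj₂ (proj₂ (proj₂ d)) _

    V : FOR → Elem
    V∈U : ∀ ψ → InU (V ψ)
    V (var p)  = value (atom p)
    V (¬f ψ)   = value (neg (V ψ) (V∈U ψ))
    V (ψ ⇒ θ)  = value (imp (V ψ) (V θ) (V∈U ψ) (V∈U θ))
    V (ψ ≡f θ) = value (eqv (V ψ) (V θ) (V∈U ψ) (V∈U θ))
    V∈U (var p)  = value∈U (atom p)
    V∈U (¬f ψ)   = value∈U (neg (V ψ) (V∈U ψ))
    V∈U (ψ ⇒ θ)  = value∈U (imp (V ψ) (V θ) (V∈U ψ) (V∈U θ))
    V∈U (ψ ≡f θ) = value∈U (eqv (V ψ) (V θ) (V∈U ψ) (V∈U θ))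

    negV : ∀ ψ → NegR (V ψ) (V (¬f ψ))
    negV ψ = holds (neg (V ψ) (V∈U ψ))

    impV : ∀ ψ θ → ImpR (V ψ) (V θ) (V (ψ ⇒ θ))
    impV ψ θ = holds (imp (V ψ) (V θ) (V∈U ψ) (V∈U θ))

    eqvV : ∀ ψ θ → EqvR (V ψ) (V θ) (V (ψ ≡f θ))
    eqvV ψ θ = holds (eqv (V ψ) (V θ) (V∈U ψ) (V∈U θ))

    unique : ∀ V' → IsDefinedV V' → ∀ ψ → V' ψ ≡ V ψ
    unique V' (_ , atom' , _) (var p) = only (atom p) (atom' p)
    unique V' d@(_ , _ , neg' , _) (¬f ψ) =
      only (neg (V ψ) (V∈U ψ))
        (subst (λ o → NegR o (V' (¬f ψ))) (unique V' d ψ) (neg' ψ))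
    unique V' d@(_ , _ , _ , imp' , _) (ψ ⇒ θ) =
      only (imp (V ψ) (V θ) (V∈U ψ) (V∈U θ))
        (subst₂ (λ o o' → ImpR o o' (V' (ψ ⇒ θ)))
                (unique V' d ψ) (unique V' d θ) (imp' ψ θ))
    unique V' d@(_ , _ , _ , _ , eqv') (ψ ≡f θ) =
      only (eqv (V ψ) (V θ) (V∈U ψ) (V∈U θ))
        (subst₂ (λ o o' → EqvR o o' (V' (ψ ≡f θ)))
                (unique V' d ψ) (unique V' d θ) (eqv' ψ θ))

module SaturatedBranch (B : Branch) (r : ℕ) (ML : Label → Set)
  (saturated : ∀ {c} → EqConcl B c → c ∈ B) (consistent : ¬ ClosurePremise B)
  (isML : IsML B r ML) where

  open BranchModel B ML r
  open BranchModelProperties B ML r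

  ≐-sym : ∀ {w v} → (w ≐ v) ∈ B → (v ≐ w) ∈ B
  ≐-sym = saturated ∘ rsym

  ≐-trans : ∀ {w v u} → (w ≐ v) ∈ B → (v ≐ u) ∈ B → (w ≐ u) ∈ B
  ≐-trans w≐v v≐u = saturated (rtran w≐v v≐u)

  approx : ∀ {a v v' ψ ψ'} → (a ≐ v) ∈ B → (a ≐ v') ∈ B →
           (v ∶ ψ) ∈ B → (v' ∶ ψ') ∈ B → Approx B ψ ψ'
  approx a≐v a≐v' v∶ψ v'∶ψ' = _ , _ , v∶ψ , v'∶ψ' , ≐-trans (≐-sym a≐v) a≐v'

  ML-sim⇒≡ : ∀ {u u'} → ML u → ML u' → Sim B u u' → u ≡ u'
  ML-sim⇒≡ {plus _}  {plus _}  u∈ML u'∈ML u≐u' =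
    let _ , _ , unique⁺ , _ = isML in unique⁺ u∈ML tt u'∈ML tt u≐u'
  ML-sim⇒≡ {minus _} {minus _} u∈ML u'∈ML u≐u' =
    let _ , _ , _ , _ , unique⁻ , _ = isML in unique⁻ u∈ML tt u'∈ML tt u≐u'
  ML-sim⇒≡ {plus i}  {minus j} _ _ u≐u' = ⊥-elim (consistent (inj₂ (i , j , u≐u')))
  ML-sim⇒≡ {minus i} {plus j}  _ _ u≐u' = ⊥-elim (consistent (inj₂ (j , i , ≐-sym u≐u')))

  representatives-≡ : ∀ {u u' t t'} → ML u → ML u' →
    Sim B u t → Sim B u' t' → Sim B t t' → u ≡ u'
  representatives-≡ u∈ML u'∈ML u≐t u'≐t' t≐t' =
    ML-sim⇒≡ u∈ML u'∈ML (≐-trans u≐t (≐-trans t≐t' (≐-sym u'≐t')))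

  representative : ∀ {w} → InL B w → ∃[ u ] (ML u × Sim B u w)
  representative {plus _} w∈L =
    let _ , rep⁺ , _ = isML ; u , u∈ML , _ , w≐u = rep⁺ w∈L tt
    in  u , u∈ML , ≐-sym w≐u
  representative {minus _} w∈L =
    let _ , _ , _ , rep⁻ , _ = isML ; u , u∈ML , _ , w≐u = rep⁻ w∈L tt
    in  u , u∈ML , ≐-sym w≐u

  w⁻∈U : InU w⁻
  w⁻∈U = let _ , _ , _ , _ , _ , r∈ML = isML in r∈ML

  negClosed? : ∀ w → Dec (∃[ u ] (ML u × NegWit w u))
  negClosed? w⁺    = no λ { (_ , _ , _ , _ , _ , () , _) }
  negClosed? ⌜ a ⌝ =
    map′ witness premises
      (∃-labelled? (λ v ψ → (a ≐ v) ∈? B ×-dec ∃-labelled? (λ _ χ → χ ≟ᶠ ¬f ψ) B) B)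
    where
    Premises : Set
    Premises = ∃[ v ] ∃[ ψ ] ((v ∶ ψ) ∈ B × (a ≐ v) ∈ B ×
               ∃[ t ] ∃[ χ ] ((t ∶ χ) ∈ B × χ ≡ ¬f ψ))

    witness : Premises → ∃[ u ] (ML u × NegWit ⌜ a ⌝ u)
    witness (v , ψ , v∶ψ , a≐v , t , _ , t∶¬ψ , refl) with representative (¬f ψ , t∶¬ψ)
    ... | u , u∈ML , u≐t = u , u∈ML , ψ , v , t , a≐v , u≐t , v∶ψ , t∶¬ψ

    premises : ∃[ u ] (ML u × NegWit ⌜ a ⌝ u) → Premises
    premises (_ , _ , ψ , v , t , a≐v , _ , v∶ψ , t∶¬ψ) =
      v , ψ , v∶ψ , a≐v , t , ¬f ψ , t∶¬ψ , refl

  negWit-unique : ∀ w {u u'} → ML u → NegWit w u → ML u' → NegWit w u' → u ≡ u'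
  negWit-unique ⌜ a ⌝ u∈ML (_ , _ , _ , a≐v , u≐t , v∶ψ , t∶¬ψ)
                      u'∈ML (_ , _ , _ , a≐v' , u'≐t' , v'∶ψ' , t'∶¬ψ') =
    representatives-≡ u∈ML u'∈ML u≐t u'≐t'
      (saturated (r≡¬ (approx a≐v a≐v' v∶ψ v'∶ψ') t∶¬ψ t'∶¬ψ'))

  -- Imp.Wit and Eqv.Wit unfold to ImpWit and EqvWit.
  module BinaryWitness (_∙_ : FOR → FOR → FOR)
    (∙-congruence : ∀ {φ ψ χ θ x z} → Approx B φ ψ → Approx B χ θ →
                    (x ∶ φ ∙ χ) ∈ B → (z ∶ ψ ∙ θ) ∈ B → (x ≐ z) ∈ B) where

    Wit : Elem → Elem → Label → Set
    Wit w v u = ∃[ ψ ] ∃[ θ ] ∃[ t ] ∃[ x ] ∃[ y ]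
      (SimE w t × SimE v x × Sim B u y × (t ∶ ψ) ∈ B × (x ∶ θ) ∈ B × (y ∶ ψ ∙ θ) ∈ B)

    Closed : Elem → Elem → Set
    Closed w v = ∃[ u ] (ML u × Wit w v u)

    closed? : ∀ w v → Dec (Closed w v)
    closed? w⁺    _     = no λ { (_ , _ , _ , _ , _ , _ , _ , () , _) }
    closed? ⌜ _ ⌝ w⁺    = no λ { (_ , _ , _ , _ , _ , _ , _ , _ , () , _) }
    closed? ⌜ a ⌝ ⌜ b ⌝ =
      map′ witness premises
        (∃-labelled? (λ t ψ → (a ≐ t) ∈? B ×-dec
          ∃-labelled? (λ x θ → (b ≐ x) ∈? B ×-dec
            ∃-labelled? (λ _ χ → χ ≟ᶠ (ψ ∙ θ)) B) B) B)
      where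
      Premises : Set
      Premises = ∃[ t ] ∃[ ψ ] ((t ∶ ψ) ∈ B × (a ≐ t) ∈ B ×
                 ∃[ x ] ∃[ θ ] ((x ∶ θ) ∈ B × (b ≐ x) ∈ B ×
                 ∃[ y ] ∃[ χ ] ((y ∶ χ) ∈ B × χ ≡ ψ ∙ θ)))

      witness : Premises → Closed ⌜ a ⌝ ⌜ b ⌝
      witness (t , ψ , t∶ψ , a≐t , x , θ , x∶θ , b≐x , y , _ , y∶ψ∙θ , refl)
        with representative (ψ ∙ θ , y∶ψ∙θ)
      ... | u , u∈ML , u≐y =
        u , u∈ML , ψ , θ , t , x , y , a≐t , b≐x , u≐y , t∶ψ , x∶θ , y∶ψ∙θ

      premises : Closed ⌜ a ⌝ ⌜ b ⌝ → Premises
      premises (_ , _ , ψ , θ , t , x , y , a≐t , b≐x , _ , t∶ψ , x∶θ , y∶ψ∙θ) =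
        t , ψ , t∶ψ , a≐t , x , θ , x∶θ , b≐x , y , ψ ∙ θ , y∶ψ∙θ , refl

    wit-unique : ∀ w v {u u'} → ML u → Wit w v u → ML u' → Wit w v u' → u ≡ u'
    wit-unique ⌜ a ⌝ ⌜ b ⌝
      u∈ML  (_ , _ , _ , _ , _ , a≐t  , b≐x  , u≐y   , t∶ψ   , x∶θ   , y∶ψ∙θ)
      u'∈ML (_ , _ , _ , _ , _ , a≐t' , b≐x' , u'≐y' , t'∶ψ' , x'∶θ' , y'∶ψ'∙θ') =
      representatives-≡ u∈ML u'∈ML u≐y u'≐y'
        (∙-congruence (approx a≐t a≐t' t∶ψ t'∶ψ') (approx b≐x b≐x' x∶θ x'∶θ')
                      y∶ψ∙θ y'∶ψ'∙θ')

  module Imp = BinaryWitness _⇒_  (λ φ≈ψ χ≈θ x z → saturated (r≡⇒ φ≈ψ χ≈θ x z))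
  module Eqv = BinaryWitness _≡f_ (λ φ≈ψ χ≈θ x z → saturated (r≡≡ φ≈ψ χ≈θ x z))

  negation-defined : ∀ w → InU w → UniqueInU (NegR w)
  negation-defined w w∈U =
    caseDefined-unique w⁻∈U (negClosed? w) (negWit-unique w)
      (¬? (negClosed? w) ×-dec ¬? (InD? w w∈U))
      (λ closed (notClosed , _) → notClosed closed)

  implication-defined : ∀ w v → InU w → InU v → UniqueInU (ImpR w v)
  implication-defined w v w∈U v∈U =
    caseDefined-unique w⁻∈U (Imp.closed? w v) (Imp.wit-unique w v)
      ((v ≟ᵉ w⁺) ⊎-dec ((w ≟ᵉ w⁺) ×-dec InD? v v∈U) ⊎-dec
        (¬? (Imp.closed? w v) ×-dec (¬? (InD? w w∈U) ⊎-dec InD? v v∈U)))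
      λ { (_ , _ , _ , _ , _ , _ , _ , _ , v∼x , _) (inj₁ refl)              → v∼x
        ; (_ , _ , _ , _ , _ , _ , _ , w∼t , _)     (inj₂ (inj₁ (refl , _))) → w∼t
        ; closed (inj₂ (inj₂ (notClosed , _))) → notClosed closed }

  equivalence-defined : ∀ w v → InU w → InU v → UniqueInU (EqvR w v)
  equivalence-defined w v _ _ =
    caseDefined-unique w⁻∈U (Eqv.closed? w v) (Eqv.wit-unique w v)
      ((w ≟ᵉ v) ×-dec ((w ≟ᵉ w⁺) ⊎-dec ¬? (Eqv.closed? w v)))
      λ { (_ , _ , _ , _ , _ , _ , _ , w∼t , _) (_ , inj₁ refl)     → w∼t
        ; closed                               (_ , inj₂ notClosed) → notClosed closed }

  atom-defined : AtomWellDefined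
  atom-defined p with ∃-labelled? (λ _ φ → φ ≟ᶠ var p) B
  ... | yes (w , _ , w∶p , refl) with representative (var p , w∶p)
  ...   | u , u∈ML , u≐w =
    ⌜ u ⌝ , u∈ML , inj₁ (w , w∶p , u , refl , u∈ML , ≐-sym u≐w) , λ
      { _ (inj₁ (w' , w'∶p , u' , refl , u'∈ML , w'≐u')) →
          cong ⌜_⌝ (representatives-≡ u'∈ML u∈ML (≐-sym w'≐u') u≐w
                                        (saturated (rF w'∶p w∶p)))
      ; _ (inj₂ (_ , unlabelled)) → ⊥-elim (unlabelled (w , w∶p)) }
  atom-defined p | no unlabelled =
    w⁺ , tt , inj₂ (refl , λ (w , w∶p) → unlabelled (w , var p , w∶p , refl)) , λ
      { _ (inj₁ (w , w∶p , _)) → ⊥-elim (unlabelled (w , var p , w∶p , refl))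
      ; _ (inj₂ (o≡w⁺ , _))    → o≡w⁺ }

  model-well-defined : ModelWellDefined
  model-well-defined = negation-defined , implication-defined , equivalence-defined

proposition11 : (φ : FOR) (r : ℕ) (B : Branch) (A : List (Label × FOR)) →
    TBranch r φ B A → Open B → FullyExpanded B A →
    (ML : Label → Set) → IsML B r ML →
    BranchModel.Conclusion B ML r
-- Only openness and full expansion of the branch are used, not the tableau derivation.
proposition11 _ _ _ _ _ open-branch (inj₁ bot∈B) _ _ = ⊥-elim (open-branch bot∈B)
proposition11 _ r B _ _ _ (inj₂ (_ , saturated , consistent)) ML isML =
  model-well-defined , atom-defined ,
  BranchModelProperties.valuation B ML r model-well-defined atom-defined
  where
  open SaturatedBranch B r ML saturated consistent isML
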